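{- Let $\mathcal{M}=U_{r,m}$ be the uniform matroid of rank $r$ on a set $E$ of size $m$ (bases are all $r$-element subsets of $E$). Then for every pair of distinct elements $e,f\in E$, the Rayleigh difference $\Delta M\{e,f\}$ is a sum of squares of real polynomials.
   Context: For a matroid on ground set $E$, let $\mathbf{y}=\{y_h:h\in E\}$ be indeterminates, $\mathbf{y}^S=\prod_{h\in S}y_h$, and let the basis enumerator be $M(\mathbf{y})=\sum_B\mathbf{y}^B$ over all bases $B$. For distinct $e,f\in E$ write uniquely $M=M^{ef}+y_eM_e^f+y_fM_f^e+y_ey_fM_{ef}$ where the four polynomials do not involve $y_e,y_f$; the Rayleigh difference is $\Delta M\{e,f\}=M_e^fM_f^e-M_{ef}M^{ef}$. -}

module Defs where

open import Data.Bool using (Bool; true; false; if_then_else_; _∧_; not)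
open import Data.Nat using (ℕ; zero; suc; _≡ᵇ_)
open import Data.Fin using (Fin; zero; suc)
open import Data.Fin.Subset using (Subset; inside; outside; ∣_∣)
open import Data.Vec using (Vec; []; _∷_; lookup; _[_]≔_)
open import Data.List using (List; []; _∷_; _++_; map; foldr; filter)
open import Data.Rational using (ℚ; 0ℚ; 1ℚ; _+_; _*_; _-_)
open import Relation.Nullary.Decidable using (Dec; yes; no)
open import Data.Bool.Properties using (T?)
open import Data.Product using (Σ)
open import Relation.Binary.PropositionalEquality using (_≡_)

allSubsets : (n : ℕ) → List (Subset n)
allSubsets zero = [] ∷ []
allSubsets (suc n) = map (outside ∷_) (allSubsets n) ++ map (inside ∷_) (allSubsets n)

monomial : {n : ℕ} → Subset n → (Fin n → ℚ) → ℚ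
monomial [] y = 1ℚ
monomial (b ∷ S) y = (if b then y zero else 1ℚ) * monomial S (λ i → y (suc i))

sumℚ : List ℚ → ℚ
sumℚ = foldr _+_ 0ℚ

-- A matroid is given here by its (decidable) collection of bases.
BasisPred : ℕ → Set
BasisPred m = Subset m → Bool

uniformBases : (r m : ℕ) → BasisPred m
uniformBases r m S = ∣ S ∣ ≡ᵇ r

partSum : {m : ℕ} → BasisPred m → (e f : Fin m) → Bool → Bool → (Fin m → ℚ) → ℚ
partSum {m} isB e f be bf y =
  sumℚ (map (λ B → monomial ((B [ e ]≔ outside) [ f ]≔ outside) y)
            (filter (λ B → T? (isB B ∧ eqB (lookup B e) be ∧ eqB (lookup B f) bf))
                    (allSubsets m)))
  where
  eqB : Bool → Bool → Bool
  eqB true b = b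
  eqB false b = not b

-- The four polynomials of M = M^{ef} + y_e M_e^f + y_f M_f^e + y_e y_f M_{ef}.
M^ef M_e^f M_f^e M_ef : {m : ℕ} → BasisPred m → (e f : Fin m) → (Fin m → ℚ) → ℚ
M^ef  isB e f = partSum isB e f false false
M_e^f isB e f = partSum isB e f true  false
M_f^e isB e f = partSum isB e f false true
M_ef  isB e f = partSum isB e f true  true

rayleighΔ : {m : ℕ} → BasisPred m → (e f : Fin m) → (Fin m → ℚ) → ℚ
rayleighΔ isB e f y = M_e^f isB e f y * M_f^e isB e f y - M_ef isB e f y * M^ef isB e f y

data Poly (n : ℕ) : Set where
  var : Fin n → Poly n
  con : ℚ → Poly n
  _⊕_ : Poly n → Poly n → Poly n
  _⊗_ : Poly n → Poly n → Poly n

eval : {n : ℕ} → Poly n → (Fin n → ℚ) → ℚ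
eval (var i) y = y i
eval (con c) y = c
eval (p ⊕ q) y = eval p y + eval q y
eval (p ⊗ q) y = eval p y * eval q y

sumOfSquares : {n : ℕ} → List (Poly n) → (Fin n → ℚ) → ℚ
sumOfSquares qs y = sumℚ (map (λ q → eval q y * eval q y) qs)

-- A polynomial function is a sum of squares of polynomials.
-- (ℚ is infinite, so equality of polynomial functions = equality of polynomials.)
IsSOS : {n : ℕ} → ((Fin n → ℚ) → ℚ) → Set
IsSOS {n} P = Σ (List (Poly n)) (λ qs → (y : Fin n → ℚ) → P y ≡ sumOfSquares qs y)

module Submission where

-- Write z for the variables other than y_e, y_f and e_k for the elementary symmetric polynomials
-- of z (e_k = 0 for k < 0). For U_{r,m} one has M_e^f = M_f^e = e_{r-1}, M_{ef} = e_{r-2} and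
-- M^{ef} = e_r, so ΔM{e,f} = e_K² − e_{K-1} e_{K+1} with K = r − 1 (and 0 if r = 0). Then
--
--   (K+1)! (e_K² − e_{K-1} e_{K+1}) = Σ_{a+p=K} a! p! Σ_{|J|=a} z_J² e_p(z ∖ J)²,
--
-- whose right-hand side is visibly a sum of squares. Every polynomial occurring here is a
-- combination of monomials z_J² z_U (J, U disjoint) with a coefficient depending only on |J| = b,
-- so the identity reduces to one identity of integers for each b; these follow from
-- Σ_{a+p=K} a! p! C(b,a) = (K+1)! / (K − b + 1).

open import Defs
open import Data.Nat using (ℕ; _≤_)
open import Data.Fin using (Fin)
open import Relation.Binary.PropositionalEquality using (_≢_)

open import Algebra.Bundles using (Ring; CommutativeRing)
open import Data.Bool using (Bool; true; false; _∧_; not; if_then_else_)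
open import Data.Bool.Properties using (T?)
open import Data.Empty using (⊥-elim)
open import Data.Fin.Subset using (Subset; inside; outside; ∣_∣)
open import Data.List using (List; []; _∷_; map; _++_; concat; replicate; filter; tabulate)
open import Data.List.Properties using (map-++; map-cong; map-∘; map-tabulate)
open import Data.Nat using (zero; suc; _<_; z≤n; s≤s; _!)
import Data.Nat as ℕ
open import Data.Nat.Properties using (+-suc; m≤n⇒m≤1+n; _!≢0)
open import Data.Product using (Σ-syntax; _,_; proj₁)
open import Data.Vec using (_∷_; lookup; _[_]≔_)
open import Function using (_∘_)
open import Level using (0ℓ)
open import Relation.Binary.PropositionalEquality
  using (_≡_; refl; sym; trans; cong; cong₂; subst; module ≡-Reasoning)
open import Relation.Nullary.Decidable using (dec⇒maybe)
open import Tactic.RingSolver.Core.AlmostCommutativeRing using (AlmostCommutativeRing; fromCommutativeRing)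

splitSum : {A : Set} → (A → A → A) → ℕ → (ℕ → ℕ → A) → A
splitSum _∙_ zero    F = F 0 0
splitSum _∙_ (suc K) F = F 0 (suc K) ∙ splitSum _∙_ K (λ a p → F (suc a) p)

splitSum-cong : ∀ {A : Set} (_∙_ : A → A → A) K {F G : ℕ → ℕ → A} →
                (∀ a p → F a p ≡ G a p) → splitSum _∙_ K F ≡ splitSum _∙_ K G
splitSum-cong _∙_ zero    F≗G = F≗G 0 0
splitSum-cong _∙_ (suc K) F≗G =
  cong₂ _∙_ (F≗G 0 (suc K)) (splitSum-cong _∙_ K (λ a p → F≗G (suc a) p))

splitSum-a+p≡K : ∀ {A : Set} (_∙_ : A → A → A) K (F : ℕ → ℕ → ℕ → A) →
                 splitSum _∙_ K (λ a p → F a p (a ℕ.+ p)) ≡ splitSum _∙_ K (λ a p → F a p K)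
splitSum-a+p≡K _∙_ zero    F = refl
splitSum-a+p≡K _∙_ (suc K) F =
  cong (F 0 (suc K) (suc K) ∙_) (splitSum-a+p≡K _∙_ K (λ a p n → F (suc a) p (suc n)))

splitSum-homo : ∀ {A B : Set} {_∙_ : A → A → A} {_◇_ : B → B → B} (h : A → B) →
                (∀ x y → h (x ∙ y) ≡ h x ◇ h y) →
                ∀ K F → h (splitSum _∙_ K F) ≡ splitSum _◇_ K (λ a p → h (F a p))
splitSum-homo h homo zero    F = refl
splitSum-homo {_◇_ = _◇_} h homo (suc K) F =
  trans (homo (F 0 (suc K)) _) (cong (h (F 0 (suc K)) ◇_) (splitSum-homo h homo K (λ a p → F (suc a) p)))

module Coefficients where

  open import Data.Nat using (_+_; _*_)
  open import Data.Nat.Properties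
    using ( +-assoc; +-comm; +-identityʳ; +-cancelʳ-≡; *-assoc; *-comm; *-identityˡ; *-identityʳ; *-zeroʳ
          ; *-distribˡ-+; *-distribʳ-+; *-cancelˡ-≡; ≤-pred; ≤-reflexive; ≤-<-connex; <⇒≱; +-mono-<
          ; m≤m+n; m≤n⇒∃[o]m+o≡n; +-commutativeSemigroup; *-commutativeSemigroup )
  open import Data.Nat.Combinatorics using (_C_; k>n⇒nCk≡0; nCk+nC[k+1]≡[n+1]C[k+1]; nC1≡n)
  open import Data.Nat.Tactic.RingSolver using (solve-∀)
  open import Data.Sum using (inj₁; inj₂)
  open import Data.Product using (_,_)
  open import Relation.Nullary using (contradiction)
  open import Algebra.Properties.CommutativeSemigroup +-commutativeSemigroup
    using () renaming (interchange to +-interchange; x∙yz≈y∙xz to +-exchange)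
  open import Algebra.Properties.CommutativeSemigroup *-commutativeSemigroup
    using () renaming (x∙yz≈y∙xz to *-exchange)
  open ≡-Reasoning

  degree : ℕ → ℕ → ℕ → ℕ
  degree a p q = (a + p) + (a + q)

  degree-sucᵃ : ∀ a p q → degree (suc a) p q ≡ suc (suc (degree a p q))
  degree-sucᵃ a p q = cong suc (+-suc (a + p) (a + q))

  degree-sucᵖ : ∀ a p q → degree a (suc p) q ≡ suc (degree a p q)
  degree-sucᵖ a p q = cong (_+ (a + q)) (+-suc a p)

  degree-sucᑫ : ∀ a p q → degree a p (suc q) ≡ suc (degree a p q)
  degree-sucᑫ a p q = trans (cong ((a + p) +_) (+-suc a q)) (+-suc (a + p) (a + q))

  degree-sucᵖᑫ : ∀ a p q → degree a (suc p) (suc q) ≡ suc (suc (degree a p q))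
  degree-sucᵖᑫ a p q = trans (degree-sucᵖ a p (suc q)) (cong suc (degree-sucᑫ a p q))

  <-halve : ∀ b {d d′} → d′ ≡ suc (suc d) → suc b + suc b < d′ → b + b < d
  <-halve b {d} refl h = subst (_≤ d) (+-suc b b) (≤-pred (≤-pred h))

  -- coeff a p q b is the coefficient of x_J² x_U, |J| = b, in Σ_{|I|=a} x_I² e_p(xs ∖ I) e_q(xs ∖ I):
  -- the square of a fixed j ∈ J comes either from x_I² (coeffSquare) or from x_j dividing both
  -- e_p and e_q (coeffProduct).
  mutual
    coeff : ℕ → ℕ → ℕ → ℕ → ℕ
    coeff a       p q (suc b) = coeffSquare a p q b + coeffProduct a p q b
    coeff zero    p q zero    = (p + q) C p
    coeff (suc a) p q zero    = 0

    coeffSquare : ℕ → ℕ → ℕ → ℕ → ℕ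
    coeffSquare zero    p q b = 0
    coeffSquare (suc a) p q b = coeff a p q b

    coeffProduct : ℕ → ℕ → ℕ → ℕ → ℕ
    coeffProduct a zero    q       b = 0
    coeffProduct a (suc p) zero    b = 0
    coeffProduct a (suc p) (suc q) b = coeff a p q b

  shiftᵖ shiftᑫ : (ℕ → ℕ → ℕ → ℕ → ℕ) → ℕ → ℕ → ℕ → ℕ → ℕ
  shiftᵖ c a zero    q b = 0
  shiftᵖ c a (suc p) q b = c a p q b
  shiftᑫ c a p zero    b = 0
  shiftᑫ c a p (suc q) b = c a p q b

  Pascal : (ℕ → ℕ → ℕ → ℕ → ℕ) → ℕ → ℕ → ℕ → ℕ → Set
  Pascal c a p q b = c a p q b ≡ shiftᵖ c a p q b + shiftᑫ c a p q b

  coeffProduct-sucᑫ : ∀ a p q b → coeffProduct a p (suc q) b ≡ shiftᵖ coeff a p q b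
  coeffProduct-sucᑫ a zero    q b = refl
  coeffProduct-sucᑫ a (suc p) q b = refl

  coeffProduct-sucᵖ : ∀ a p q b → coeffProduct a (suc p) q b ≡ shiftᑫ coeff a p q b
  coeffProduct-sucᵖ a p zero    b = refl
  coeffProduct-sucᵖ a p (suc q) b = refl

  shiftᵖ-suc : ∀ a p q b →
               shiftᵖ coeffSquare a p q b + shiftᵖ coeffProduct a p q b ≡ shiftᵖ coeff a p q (suc b)
  shiftᵖ-suc a zero    q b = refl
  shiftᵖ-suc a (suc p) q b = refl

  shiftᑫ-suc : ∀ a p q b →
               shiftᑫ coeffSquare a p q b + shiftᑫ coeffProduct a p q b ≡ shiftᑫ coeff a p q (suc b)
  shiftᑫ-suc a p zero    b = refl
  shiftᑫ-suc a p (suc q) b = refl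

  mutual
    coeff-pascal : ∀ b a p q → b + b < degree a p q → Pascal coeff a p q b
    coeff-pascal zero (suc a) zero    zero    _ = refl
    coeff-pascal zero (suc a) zero    (suc q) _ = refl
    coeff-pascal zero (suc a) (suc p) zero    _ = refl
    coeff-pascal zero (suc a) (suc p) (suc q) _ = refl
    coeff-pascal zero zero    zero    zero    ()
    coeff-pascal zero zero    zero    (suc q) _ = refl
    coeff-pascal zero zero    (suc p) zero    _ =
      trans (sym (nCk+nC[k+1]≡[n+1]C[k+1] (p + 0) p))
            (cong ((p + 0) C p +_) (k>n⇒nCk≡0 (s≤s (≤-reflexive (+-identityʳ p)))))
    coeff-pascal zero zero    (suc p) (suc q) _ =
      trans (sym (nCk+nC[k+1]≡[n+1]C[k+1] (p + suc q) p))
            (cong (λ n → (p + suc q) C p + n C suc p) (+-suc p q))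
    coeff-pascal (suc b) a p q h = begin
      coeffSquare a p q b + coeffProduct a p q b
        ≡⟨ cong₂ _+_ (square-pascal b a p q h) (product-pascal b a p q h) ⟩
      (Sᵖ + Sᑫ) + (Pᵖ + Pᑫ)  ≡⟨ +-interchange Sᵖ Sᑫ Pᵖ Pᑫ ⟩
      (Sᵖ + Pᵖ) + (Sᑫ + Pᑫ)  ≡⟨ cong₂ _+_ (shiftᵖ-suc a p q b) (shiftᑫ-suc a p q b) ⟩
      shiftᵖ coeff a p q (suc b) + shiftᑫ coeff a p q (suc b) ∎
      where
      Sᵖ = shiftᵖ coeffSquare a p q b
      Sᑫ = shiftᑫ coeffSquare a p q b
      Pᵖ = shiftᵖ coeffProduct a p q b
      Pᑫ = shiftᑫ coeffProduct a p q b

    square-pascal : ∀ b a p q → suc b + suc b < degree a p q → Pascal coeffSquare a p q b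
    square-pascal b zero    zero    zero    _ = refl
    square-pascal b zero    zero    (suc q) _ = refl
    square-pascal b zero    (suc p) zero    _ = refl
    square-pascal b zero    (suc p) (suc q) _ = refl
    square-pascal b (suc a) zero    zero    h =
      coeff-pascal b a zero zero (<-halve b (degree-sucᵃ a zero zero) h)
    square-pascal b (suc a) zero    (suc q) h =
      coeff-pascal b a zero (suc q) (<-halve b (degree-sucᵃ a zero (suc q)) h)
    square-pascal b (suc a) (suc p) zero    h =
      coeff-pascal b a (suc p) zero (<-halve b (degree-sucᵃ a (suc p) zero) h)
    square-pascal b (suc a) (suc p) (suc q) h =
      coeff-pascal b a (suc p) (suc q) (<-halve b (degree-sucᵃ a (suc p) (suc q)) h)

    product-pascal : ∀ b a p q → suc b + suc b < degree a p q → Pascal coeffProduct a p q b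
    product-pascal b a zero    zero    _ = refl
    product-pascal b a zero    (suc q) _ = refl
    product-pascal b a (suc zero)    zero    _ = refl
    product-pascal b a (suc (suc p)) zero    _ = refl
    product-pascal b a (suc p)       (suc q) h =
      trans (coeff-pascal b a p q (<-halve b (degree-sucᵖᑫ a p q) h))
            (sym (cong₂ _+_ (coeffProduct-sucᑫ a p q b) (coeffProduct-sucᵖ a p q b)))

  coeff-vanishesᵖ : ∀ s t b → s < b → coeff 0 s t b ≡ 0
  coeff-vanishesᵖ zero    t       (suc b) _         = refl
  coeff-vanishesᵖ (suc s) zero    (suc b) _         = refl
  coeff-vanishesᵖ (suc s) (suc t) (suc b) (s≤s s<b) = coeff-vanishesᵖ s t b s<b

  coeff-vanishesᑫ : ∀ s t b → t < b → coeff 0 s t b ≡ 0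
  coeff-vanishesᑫ zero    t       (suc b) _         = refl
  coeff-vanishesᑫ (suc s) zero    (suc b) _         = refl
  coeff-vanishesᑫ (suc s) (suc t) (suc b) (s≤s t<b) = coeff-vanishesᑫ s t b t<b

  coeff-diagonal : ∀ b s t → coeff 0 (b + s) (b + t) b ≡ (s + t) C s
  coeff-diagonal zero    s t = refl
  coeff-diagonal (suc b) s t = coeff-diagonal b s t

  mutual
    coeff-factor : ∀ b a p q → coeff a p q b ≡ (b C a) * coeff 0 (a + p) (a + q) b
    coeff-factor zero    zero    p q = sym (*-identityˡ (coeff 0 p q 0))
    coeff-factor zero    (suc a) p q = refl
    coeff-factor (suc b) zero    p q = sym (*-identityˡ (coeff 0 p q (suc b)))
    coeff-factor (suc b) (suc a) p q = begin
      coeff a p q b + coeffProduct (suc a) p q b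
        ≡⟨ cong₂ _+_ (coeff-factor b a p q) (product-factor b a p q) ⟩
      (b C a) * c + (b C suc a) * c ≡⟨ *-distribʳ-+ c (b C a) (b C suc a) ⟨
      (b C a + b C suc a) * c       ≡⟨ cong (_* c) (nCk+nC[k+1]≡[n+1]C[k+1] b a) ⟩
      (suc b C suc a) * c           ∎
      where c = coeff 0 (a + p) (a + q) b

    product-factor : ∀ b a p q → coeffProduct (suc a) p q b ≡ (b C suc a) * coeff 0 (a + p) (a + q) b
    product-factor b a (suc p) (suc q) =
      trans (coeff-factor b (suc a) p q)
            (cong₂ (λ s t → (b C suc a) * coeff 0 s t b) (sym (+-suc a p)) (sym (+-suc a q)))
    product-factor b a zero q with ≤-<-connex b a
    ... | inj₁ b≤a = sym (cong (_* coeff 0 (a + 0) (a + q) b) (k>n⇒nCk≡0 (s≤s b≤a)))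
    ... | inj₂ a<b = sym (trans (cong ((b C suc a) *_) (coeff-vanishesᵖ (a + 0) (a + q) b a+0<b))
                                (*-zeroʳ (b C suc a)))
      where a+0<b = subst (_< b) (sym (+-identityʳ a)) a<b
    product-factor b a (suc p) zero with ≤-<-connex b a
    ... | inj₁ b≤a = sym (cong (_* coeff 0 (a + suc p) (a + 0) b) (k>n⇒nCk≡0 (s≤s b≤a)))
    ... | inj₂ a<b = sym (trans (cong ((b C suc a) *_) (coeff-vanishesᑫ (a + suc p) (a + 0) b a+0<b))
                                (*-zeroʳ (b C suc a)))
      where a+0<b = subst (_< b) (sym (+-identityʳ a)) a<b

  [k+1]*nC[k+1]+k*nCk≡n*nCk : ∀ n k → suc k * (n C suc k) + k * (n C k) ≡ n * (n C k)
  [k+1]*nC[k+1]+k*nCk≡n*nCk zero    zero    = refl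
  [k+1]*nC[k+1]+k*nCk≡n*nCk zero    (suc k) = cong₂ _+_ (*-zeroʳ (suc (suc k))) (*-zeroʳ (suc k))
  [k+1]*nC[k+1]+k*nCk≡n*nCk (suc n) zero    =
    trans (+-identityʳ _) (trans (*-identityˡ _) (trans (nC1≡n (suc n)) (sym (*-identityʳ (suc n)))))
  [k+1]*nC[k+1]+k*nCk≡n*nCk (suc n) (suc k) = begin
    (2 + k) * (suc n C (2 + k)) + suc k * (suc n C suc k)
      ≡⟨ cong₂ (λ x y → (2 + k) * x + suc k * y) (sym (nCk+nC[k+1]≡[n+1]C[k+1] n (suc k)))
                                                  (sym (nCk+nC[k+1]≡[n+1]C[k+1] n k)) ⟩
    (2 + k) * (c₁ + c₂) + suc k * (c₀ + c₁)
      ≡⟨ regroup k c₀ c₁ c₂ ⟩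
    ((2 + k) * c₂ + suc k * c₁) + ((suc k * c₁ + k * c₀) + (c₀ + c₁))
      ≡⟨ cong₂ (λ x y → x + (y + (c₀ + c₁)))
               ([k+1]*nC[k+1]+k*nCk≡n*nCk n (suc k)) ([k+1]*nC[k+1]+k*nCk≡n*nCk n k) ⟩
    n * c₁ + (n * c₀ + (c₀ + c₁))
      ≡⟨ collect n c₀ c₁ ⟩
    suc n * (c₀ + c₁)
      ≡⟨ cong (suc n *_) (nCk+nC[k+1]≡[n+1]C[k+1] n k) ⟩
    suc n * (suc n C suc k) ∎
    where
    c₀ = n C k
    c₁ = n C suc k
    c₂ = n C (2 + k)
    regroup : ∀ k c₀ c₁ c₂ → (2 + k) * (c₁ + c₂) + suc k * (c₀ + c₁) ≡
                             ((2 + k) * c₂ + suc k * c₁) + ((suc k * c₁ + k * c₀) + (c₀ + c₁))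
    regroup = solve-∀
    collect : ∀ n c₀ c₁ → n * c₁ + (n * c₀ + (c₀ + c₁)) ≡ suc n * (c₀ + c₁)
    collect = solve-∀

  central-binomial : ∀ m → suc m * ((suc m + suc m) C suc m) ≡ suc (suc m) * ((suc m + suc m) C m)
  central-binomial m = +-cancelʳ-≡ (m * c) _ _ (trans ([k+1]*nC[k+1]+k*nCk≡n*nCk n m) (split m c))
    where
    n = suc m + suc m
    c = n C m
    split : ∀ m c → (suc m + suc m) * c ≡ suc (suc m) * c + m * c
    split = solve-∀

  splitSum-+ : ∀ K (F G : ℕ → ℕ → ℕ) →
               splitSum _+_ K (λ a p → F a p + G a p) ≡ splitSum _+_ K F + splitSum _+_ K G
  splitSum-+ zero    F G = refl
  splitSum-+ (suc K) F G =
    trans (cong (F 0 (suc K) + G 0 (suc K) +_) (splitSum-+ K (λ a p → F (suc a) p) (λ a p → G (suc a) p)))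
          (+-interchange (F 0 (suc K)) (G 0 (suc K)) _ _)

  splitSum-*ˡ : ∀ K c (F : ℕ → ℕ → ℕ) →
                splitSum _+_ K (λ a p → c * F a p) ≡ c * splitSum _+_ K F
  splitSum-*ˡ K c F = sym (splitSum-homo (c *_) (*-distribˡ-+ c) K F)

  splitSum-*ʳ : ∀ K c (F : ℕ → ℕ → ℕ) →
                splitSum _+_ K (λ a p → F a p * c) ≡ splitSum _+_ K F * c
  splitSum-*ʳ K c F = begin
    splitSum _+_ K (λ a p → F a p * c) ≡⟨ splitSum-cong _+_ K (λ a p → *-comm (F a p) c) ⟩
    splitSum _+_ K (λ a p → c * F a p) ≡⟨ splitSum-*ˡ K c F ⟩
    c * splitSum _+_ K F               ≡⟨ *-comm c _ ⟩
    splitSum _+_ K F * c               ∎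

  splitSum-zeros : ∀ K → splitSum _+_ K (λ _ _ → 0) ≡ 0
  splitSum-zeros zero    = refl
  splitSum-zeros (suc K) = splitSum-zeros K

  splitSum-last : ∀ K (F : ℕ → ℕ → ℕ) →
                  splitSum _+_ (suc K) F ≡ splitSum _+_ K (λ a p → F a (suc p)) + F (suc K) 0
  splitSum-last zero    F = refl
  splitSum-last (suc K) F =
    trans (cong (F 0 (2 + K) +_) (splitSum-last K (λ a p → F (suc a) p))) (sym (+-assoc (F 0 (2 + K)) _ _))

  factorialSum : ℕ → ℕ → ℕ
  factorialSum K b = splitSum _+_ K (λ a p → a ! * p ! * (b C a))

  factorialSum-zero : ∀ K → factorialSum K 0 ≡ K !
  factorialSum-zero zero    = refl
  factorialSum-zero (suc K) = begin
    1 * (suc K) ! * 1 + splitSum _+_ K (λ a p → (suc a) ! * p ! * 0)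
      ≡⟨ cong (1 * (suc K) ! * 1 +_) (trans (splitSum-cong _+_ K (λ a p → *-zeroʳ ((suc a) ! * p !)))
                                            (splitSum-zeros K)) ⟩
    1 * (suc K) ! * 1 + 0
      ≡⟨ simplify ((suc K) !) ⟩
    (suc K) ! ∎
    where
    simplify : ∀ x → 1 * x * 1 + 0 ≡ x
    simplify = solve-∀

  factorialSum-suc : ∀ K b → b ≤ K → factorialSum (suc K) (suc b) ≡ (2 + K) * factorialSum K b
  factorialSum-suc K b b≤K = begin
    D + splitSum _+_ K (λ a p → (suc a) ! * p ! * (suc b C suc a))
      ≡⟨ cong (D +_) (trans (splitSum-cong _+_ K λ a p → pascal a p) (splitSum-+ K _ _)) ⟩
    D + (A + X)            ≡⟨ +-exchange D A X ⟩
    A + (D + X)            ≡⟨ cong (A +_) D+X≡Y ⟩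
    A + Y                  ≡⟨ splitSum-+ K _ _ ⟨
    splitSum _+_ K (λ a p → (suc a) ! * p ! * (b C a) + a ! * (suc p) ! * (b C a))
      ≡⟨ splitSum-cong _+_ K (λ a p → factor a p (a !) (p !) (b C a)) ⟩
    splitSum _+_ K (λ a p → (2 + (a + p)) * (a ! * p ! * (b C a)))
      ≡⟨ splitSum-a+p≡K _+_ K (λ a p n → (2 + n) * (a ! * p ! * (b C a))) ⟩
    splitSum _+_ K (λ a p → (2 + K) * (a ! * p ! * (b C a)))
      ≡⟨ splitSum-*ˡ K (2 + K) _ ⟩
    (2 + K) * factorialSum K b ∎
    where
    D = 1 * (suc K) ! * 1
    A = splitSum _+_ K (λ a p → (suc a) ! * p ! * (b C a))
    X = splitSum _+_ K (λ a p → (suc a) ! * p ! * (b C suc a))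
    Y = splitSum _+_ K (λ a p → a ! * (suc p) ! * (b C a))
    pascal : ∀ a p → (suc a) ! * p ! * (suc b C suc a) ≡
                     (suc a) ! * p ! * (b C a) + (suc a) ! * p ! * (b C suc a)
    pascal a p = trans (cong ((suc a) ! * p ! *_) (sym (nCk+nC[k+1]≡[n+1]C[k+1] b a)))
                       (*-distribˡ-+ ((suc a) ! * p !) (b C a) (b C suc a))
    D+X≡Y : D + X ≡ Y
    D+X≡Y = begin
      factorialSum (suc K) b           ≡⟨ splitSum-last K (λ a p → a ! * p ! * (b C a)) ⟩
      Y + (suc K) ! * 1 * (b C suc K)  ≡⟨ cong (λ c → Y + (suc K) ! * 1 * c) (k>n⇒nCk≡0 (s≤s b≤K)) ⟩
      Y + (suc K) ! * 1 * 0            ≡⟨ cong (Y +_) (*-zeroʳ ((suc K) ! * 1)) ⟩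
      Y + 0                            ≡⟨ +-identityʳ Y ⟩
      Y                                ∎
    factor : ∀ a p α π c → (suc a * α) * π * c + α * (suc p * π) * c ≡ (2 + (a + p)) * (α * π * c)
    factor = solve-∀

  factorialSum-closedForm : ∀ b s → suc s * factorialSum (b + s) b ≡ (suc (b + s)) !
  factorialSum-closedForm zero    s = cong (suc s *_) (factorialSum-zero s)
  factorialSum-closedForm (suc b) s = begin
    suc s * factorialSum (suc (b + s)) (suc b)
      ≡⟨ cong (suc s *_) (factorialSum-suc (b + s) b (m≤m+n b s)) ⟩
    suc s * ((2 + (b + s)) * factorialSum (b + s) b)
      ≡⟨ *-exchange (suc s) (2 + (b + s)) (factorialSum (b + s) b) ⟩
    (2 + (b + s)) * (suc s * factorialSum (b + s) b)
      ≡⟨ cong ((2 + (b + s)) *_) (factorialSum-closedForm b s) ⟩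
    (2 + (b + s)) * (suc (b + s)) ! ∎

  coeff-ratio : ∀ b s → s * coeff 0 (b + s) (b + s) b ≡ suc s * shiftᵖ coeff 0 (b + s) (suc (b + s)) b
  coeff-ratio zero    zero    = refl
  coeff-ratio (suc b) zero    =
    sym (trans (*-identityˡ _)
               (coeff-vanishesᵖ (b + 0) (2 + (b + 0)) (suc b) (s≤s (≤-reflexive (+-identityʳ b)))))
  coeff-ratio b       (suc m) = begin
    suc m * coeff 0 (b + suc m) (b + suc m) b
      ≡⟨ cong (suc m *_) (coeff-diagonal b (suc m) (suc m)) ⟩
    suc m * ((suc m + suc m) C suc m)
      ≡⟨ central-binomial m ⟩
    (2 + m) * ((suc m + suc m) C m)
      ≡⟨ cong (λ n → (2 + m) * (n C m)) (+-suc m (suc m)) ⟨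
    (2 + m) * ((m + (2 + m)) C m)
      ≡⟨ cong ((2 + m) *_) (coeff-diagonal b m (2 + m)) ⟨
    (2 + m) * coeff 0 (b + m) (b + (2 + m)) b
      ≡⟨ cong (λ n → (2 + m) * coeff 0 (b + m) n b) b+[2+m]≡2+[b+m] ⟩
    (2 + m) * coeff 0 (b + m) (2 + (b + m)) b
      ≡⟨ cong (λ n → (2 + m) * shiftᵖ coeff 0 n (suc n) b) (+-suc b m) ⟨
    (2 + m) * shiftᵖ coeff 0 (b + suc m) (suc (b + suc m)) b ∎
    where
    b+[2+m]≡2+[b+m] : b + (2 + m) ≡ 2 + (b + m)
    b+[2+m]≡2+[b+m] = trans (+-suc b (suc m)) (cong suc (+-suc b m))

  newton-cancel : ∀ D X Y T s → suc s * T ≡ D → s * X ≡ suc s * Y → D * X ≡ D * Y + T * X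
  newton-cancel D X Y T s [1+s]T≡D sX≡[1+s]Y = *-cancelˡ-≡ (D * X) (D * Y + T * X) (suc s) (begin
    suc s * (D * X)               ≡⟨ expand s D X ⟩
    D * X + D * (s * X)           ≡⟨ cong (λ z → D * X + D * z) sX≡[1+s]Y ⟩
    D * X + D * (suc s * Y)       ≡⟨ +-comm (D * X) _ ⟩
    D * (suc s * Y) + D * X       ≡⟨ cong (λ t → D * (suc s * Y) + t * X) [1+s]T≡D ⟨
    D * (suc s * Y) + suc s * T * X ≡⟨ collect s D Y T X ⟩
    suc s * (D * Y + T * X)       ∎)
    where
    expand : ∀ s D X → suc s * (D * X) ≡ D * X + D * (s * X)
    expand = solve-∀
    collect : ∀ s D Y T X → D * (suc s * Y) + suc s * T * X ≡ suc s * (D * Y + T * X)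
    collect = solve-∀

  coeff-newton : ∀ K b → b ≤ K →
                 (suc K) ! * coeff 0 K K b ≡
                 (suc K) ! * shiftᵖ coeff 0 K (suc K) b + splitSum _+_ K (λ a p → a ! * p ! * coeff a p p b)
  coeff-newton K b b≤K with m≤n⇒∃[o]m+o≡n b≤K
  ... | s , refl = trans (newton-cancel ((suc K) !) X Y (factorialSum K b) s
                                        (factorialSum-closedForm b s) (coeff-ratio b s))
                         (cong ((suc K) ! * Y +_) (sym weighted))
    where
    X = coeff 0 K K b
    Y = shiftᵖ coeff 0 K (suc K) b
    weighted : splitSum _+_ K (λ a p → a ! * p ! * coeff a p p b) ≡ factorialSum K b * X
    weighted = begin
      splitSum _+_ K (λ a p → a ! * p ! * coeff a p p b)
        ≡⟨ splitSum-cong _+_ K (λ a p → cong (a ! * p ! *_) (coeff-factor b a p p)) ⟩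
      splitSum _+_ K (λ a p → a ! * p ! * ((b C a) * coeff 0 (a + p) (a + p) b))
        ≡⟨ splitSum-a+p≡K _+_ K (λ a p n → a ! * p ! * ((b C a) * coeff 0 n n b)) ⟩
      splitSum _+_ K (λ a p → a ! * p ! * ((b C a) * X))
        ≡⟨ splitSum-cong _+_ K (λ a p → sym (*-assoc (a ! * p !) (b C a) X)) ⟩
      splitSum _+_ K (λ a p → a ! * p ! * (b C a) * X)
        ≡⟨ splitSum-*ʳ K X _ ⟩
      factorialSum K b * X ∎

  b+b≤K+K⇒b≤K : ∀ b K → b + b ≤ K + K → b ≤ K
  b+b≤K+K⇒b≤K b K b+b≤K+K with ≤-<-connex b K
  ... | inj₁ b≤K = b≤K
  ... | inj₂ K<b = contradiction b+b≤K+K (<⇒≱ (+-mono-< K<b K<b))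

open Coefficients
  using ( degree; degree-sucᵃ; degree-sucᵖ; degree-sucᑫ; degree-sucᵖᑫ; coeff; coeffSquare; coeffProduct
        ; shiftᵖ; shiftᑫ; coeff-pascal; coeff-newton; b+b≤K+K⇒b≤K )

open import Data.Rational as ℚ using (ℚ; 0ℚ; 1ℚ; _+_; _*_; _-_; 1/_)
import Data.Rational.Properties as ℚₚ
open import Algebra.Properties.Semiring.Mult (Ring.semiring ℚₚ.+-*-ring) using (_×_; ×-homo-+; ×1-homo-*)
open import Tactic.RingSolver using (solve-∀)
open import Algebra.Properties.CommutativeSemigroup
  (CommutativeRing.*-commutativeSemigroup ℚₚ.+-*-commutativeRing) using (x∙yz≈y∙xz)
open import Data.Fin using (zero; suc)

ℚ-ring : AlmostCommutativeRing 0ℓ 0ℓ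
ℚ-ring = fromCommutativeRing ℚₚ.+-*-commutativeRing (λ x → dec⇒maybe (0ℚ ℚ.≟ x))

toℚ : ℕ → ℚ
toℚ n = n × 1ℚ

toℚ-+ : ∀ m n → toℚ (m ℕ.+ n) ≡ toℚ m + toℚ n
toℚ-+ = ×-homo-+ 1ℚ

toℚ-* : ∀ m n → toℚ (m ℕ.* n) ≡ toℚ m * toℚ n
toℚ-* = ×1-homo-*

mutual
  toℚ-nonNegative : ∀ n → ℚ.NonNegative (toℚ n)
  toℚ-nonNegative zero    = _
  toℚ-nonNegative (suc n) = ℚₚ.pos⇒nonNeg (toℚ (suc n)) {{toℚ-positive n}}

  toℚ-positive : ∀ n → ℚ.Positive (toℚ (suc n))
  toℚ-positive n = ℚₚ.pos+nonNeg⇒pos 1ℚ (toℚ n) {{toℚ-nonNegative n}}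

toℚ-nonZero : ∀ n .{{_ : ℕ.NonZero n}} → ℚ.NonZero (toℚ n)
toℚ-nonZero (suc n) = ℚₚ.pos⇒nonZero (toℚ (suc n)) {{toℚ-positive n}}

prev : (ℕ → ℚ) → ℕ → ℚ
prev F zero    = 0ℚ
prev F (suc k) = F k

prev-cong : ∀ {F G : ℕ → ℚ} → (∀ k → F k ≡ G k) → ∀ k → prev F k ≡ prev G k
prev-cong F≗G zero    = refl
prev-cong F≗G (suc k) = F≗G k

prev-+ : ∀ F G k → prev (λ n → F n + G n) k ≡ prev F k + prev G k
prev-+ F G zero    = sym (ℚₚ.+-identityʳ 0ℚ)
prev-+ F G (suc k) = refl

prev-*ˡ : ∀ c F k → prev (λ n → c * F n) k ≡ c * prev F k
prev-*ˡ c F zero    = sym (ℚₚ.*-zeroʳ c)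
prev-*ˡ c F (suc k) = refl

prev-zero : ∀ {F : ℕ → ℚ} → (∀ k → F k ≡ 0ℚ) → ∀ k → prev F k ≡ 0ℚ
prev-zero F≗0 zero    = refl
prev-zero F≗0 (suc k) = F≗0 k

esym : List ℚ → ℕ → ℚ
esym []       zero    = 1ℚ
esym []       (suc k) = 0ℚ
esym (x ∷ xs) k       = esym xs k + x * prev (esym xs) k

-- Ψ xs a F = Σ_{J ⊆ xs, |J| = a} (∏_{j ∈ J} x_j²) F (xs ∖ J).
Ψ : List ℚ → ℕ → (List ℚ → ℚ) → ℚ
Ψ []       zero    F = F []
Ψ []       (suc a) F = 0ℚ
Ψ (x ∷ xs) zero    F = Ψ xs zero (λ R → F (x ∷ R))
Ψ (x ∷ xs) (suc a) F = Ψ xs (suc a) (λ R → F (x ∷ R)) + (x * x) * Ψ xs a F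

Ψ-cong : ∀ xs a {F G : List ℚ → ℚ} → (∀ R → F R ≡ G R) → Ψ xs a F ≡ Ψ xs a G
Ψ-cong []       zero    F≗G = F≗G []
Ψ-cong []       (suc a) F≗G = refl
Ψ-cong (x ∷ xs) zero    F≗G = Ψ-cong xs zero (λ R → F≗G (x ∷ R))
Ψ-cong (x ∷ xs) (suc a) F≗G =
  cong₂ (λ u v → u + (x * x) * v) (Ψ-cong xs (suc a) (λ R → F≗G (x ∷ R))) (Ψ-cong xs a F≗G)

Ψ-+ : ∀ xs a (F G : List ℚ → ℚ) → Ψ xs a (λ R → F R + G R) ≡ Ψ xs a F + Ψ xs a G
Ψ-+ []       zero    F G = refl
Ψ-+ []       (suc a) F G = sym (ℚₚ.+-identityʳ 0ℚ)
Ψ-+ (x ∷ xs) zero    F G = Ψ-+ xs zero (λ R → F (x ∷ R)) (λ R → G (x ∷ R))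
Ψ-+ (x ∷ xs) (suc a) F G =
  trans (cong₂ (λ u v → u + (x * x) * v) (Ψ-+ xs (suc a) (F ∘ (x ∷_)) (G ∘ (x ∷_))) (Ψ-+ xs a F G))
        (regroup (Ψ xs (suc a) (F ∘ (x ∷_))) (Ψ xs (suc a) (G ∘ (x ∷_))) (x * x) (Ψ xs a F) (Ψ xs a G))
  where
  regroup : ∀ u v w s t → (u + v) + w * (s + t) ≡ (u + w * s) + (v + w * t)
  regroup = solve-∀ ℚ-ring

Ψ-*ˡ : ∀ xs a c (F : List ℚ → ℚ) → Ψ xs a (λ R → c * F R) ≡ c * Ψ xs a F
Ψ-*ˡ []       zero    c F = refl
Ψ-*ˡ []       (suc a) c F = sym (ℚₚ.*-zeroʳ c)
Ψ-*ˡ (x ∷ xs) zero    c F = Ψ-*ˡ xs zero c (λ R → F (x ∷ R))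
Ψ-*ˡ (x ∷ xs) (suc a) c F =
  trans (cong₂ (λ u v → u + (x * x) * v) (Ψ-*ˡ xs (suc a) c (λ R → F (x ∷ R))) (Ψ-*ˡ xs a c F))
        (regroup c (Ψ xs (suc a) (λ R → F (x ∷ R))) (x * x) (Ψ xs a F))
  where
  regroup : ∀ c u w s → c * u + w * (c * s) ≡ c * (u + w * s)
  regroup = solve-∀ ℚ-ring

Ψ-zero : ∀ xs a → Ψ xs a (λ _ → 0ℚ) ≡ 0ℚ
Ψ-zero xs a = trans (Ψ-*ˡ xs a 0ℚ (λ _ → 0ℚ)) (ℚₚ.*-zeroˡ (Ψ xs a (λ _ → 0ℚ)))

Ψ-noSquares : ∀ xs F → Ψ xs zero F ≡ F xs
Ψ-noSquares []       F = refl
Ψ-noSquares (x ∷ xs) F = Ψ-noSquares xs (λ R → F (x ∷ R))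

-- Γ xs g N is the polynomial Σ g |J| x_J² x_U over disjoint J, U ⊆ xs with 2|J| + |U| = N.
Γ : List ℚ → (ℕ → ℕ) → ℕ → ℚ
Γ []       g zero    = toℚ (g 0)
Γ []       g (suc N) = 0ℚ
Γ (x ∷ xs) g N       =
  Γ xs g N + x * prev (Γ xs g) N + (x * x) * prev (prev (Γ xs (λ b → g (suc b)))) N

Γ-cong : ∀ xs N {g h : ℕ → ℕ} → (∀ b → b ℕ.+ b ≤ N → g b ≡ h b) → Γ xs g N ≡ Γ xs h N
Γ-cong []       zero    g≈h = cong toℚ (g≈h 0 z≤n)
Γ-cong []       (suc N) g≈h = refl
Γ-cong (x ∷ xs) N {g} {h} g≈h =
  cong₂ _+_ (cong₂ (λ u v → u + x * v) (Γ-cong xs N g≈h) (shifted N g≈h))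
            (cong ((x * x) *_) (shifted₂ N g≈h))
  where
  shifted : ∀ N → (∀ b → b ℕ.+ b ≤ N → g b ≡ h b) →
            prev (Γ xs g) N ≡ prev (Γ xs h) N
  shifted zero    _   = refl
  shifted (suc N) g≈h = Γ-cong xs N (λ b b+b≤N → g≈h b (m≤n⇒m≤1+n b+b≤N))
  shifted₂ : ∀ N → (∀ b → b ℕ.+ b ≤ N → g b ≡ h b) →
             prev (prev (Γ xs (λ b → g (suc b)))) N ≡
             prev (prev (Γ xs (λ b → h (suc b)))) N
  shifted₂ zero          _   = refl
  shifted₂ (suc zero)    _   = refl
  shifted₂ (suc (suc N)) g≈h = Γ-cong xs N λ b b+b≤N →
    g≈h (suc b) (s≤s (subst (_≤ suc N) (sym (+-suc b b)) (s≤s b+b≤N)))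

mutual
  Γ-+ : ∀ xs N (g h : ℕ → ℕ) → Γ xs (λ b → g b ℕ.+ h b) N ≡ Γ xs g N + Γ xs h N
  Γ-+ []       zero    g h = toℚ-+ (g 0) (h 0)
  Γ-+ []       (suc N) g h = sym (ℚₚ.+-identityʳ 0ℚ)
  Γ-+ (x ∷ xs) N       g h =
    trans (cong₂ _+_ (cong₂ (λ u v → u + x * v) (Γ-+ xs N g h) (prev-Γ-+ xs N g h))
                     (cong ((x * x) *_) (prev²-Γ-+ xs N (g ∘ suc) (h ∘ suc))))
          (regroup (Γ xs g N) (Γ xs h N) x (prev (Γ xs g) N) (prev (Γ xs h) N)
                   (prev (prev (Γ xs (g ∘ suc))) N) (prev (prev (Γ xs (h ∘ suc))) N))
    where
    regroup : ∀ u v x s t y z →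
              (u + v) + x * (s + t) + (x * x) * (y + z) ≡ (u + x * s + (x * x) * y) + (v + x * t + (x * x) * z)
    regroup = solve-∀ ℚ-ring

  prev-Γ-+ : ∀ xs N (g h : ℕ → ℕ) →
             prev (Γ xs (λ b → g b ℕ.+ h b)) N ≡ prev (Γ xs g) N + prev (Γ xs h) N
  prev-Γ-+ xs N g h = trans (prev-cong (λ n → Γ-+ xs n g h) N) (prev-+ _ _ N)

  prev²-Γ-+ : ∀ xs N (g h : ℕ → ℕ) →
              prev (prev (Γ xs (λ b → g b ℕ.+ h b))) N ≡
              prev (prev (Γ xs g)) N + prev (prev (Γ xs h)) N
  prev²-Γ-+ xs N g h = trans (prev-cong (λ k → prev-Γ-+ xs k g h) N) (prev-+ _ _ N)

Γ-*ˡ : ∀ xs N c (g : ℕ → ℕ) → Γ xs (λ b → c ℕ.* g b) N ≡ toℚ c * Γ xs g N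
Γ-*ˡ []       zero    c g = toℚ-* c (g 0)
Γ-*ˡ []       (suc N) c g = sym (ℚₚ.*-zeroʳ (toℚ c))
Γ-*ˡ (x ∷ xs) N       c g =
  trans (cong₂ _+_ (cong₂ (λ u v → u + x * v) (Γ-*ˡ xs N c g) (prev-Γ-*ˡ N g))
                   (cong ((x * x) *_) (trans (prev-cong (λ k → prev-Γ-*ˡ k (g ∘ suc)) N)
                                             (prev-*ˡ (toℚ c) _ N))))
        (regroup (toℚ c) (Γ xs g N) x (prev (Γ xs g) N) (prev (prev (Γ xs (g ∘ suc))) N))
  where
  prev-Γ-*ˡ : ∀ N g → prev (Γ xs (λ b → c ℕ.* g b)) N ≡ toℚ c * prev (Γ xs g) N
  prev-Γ-*ˡ N g = trans (prev-cong (λ n → Γ-*ˡ xs n c g) N) (prev-*ˡ (toℚ c) _ N)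
  regroup : ∀ c u x s y → c * u + x * (c * s) + (x * x) * (c * y) ≡ c * (u + x * s + (x * x) * y)
  regroup = solve-∀ ℚ-ring

Γ-zero : ∀ xs N → Γ xs (λ _ → 0) N ≡ 0ℚ
Γ-zero xs N = trans (Γ-*ˡ xs N 0 (λ _ → 0)) (ℚₚ.*-zeroˡ (Γ xs (λ _ → 0) N))

Γ-pascal : ∀ xs a p q →
           prev (Γ xs (coeff a p q)) (degree a p q) ≡
           prev (Γ xs (shiftᵖ coeff a p q)) (degree a p q) + prev (Γ xs (shiftᑫ coeff a p q)) (degree a p q)
Γ-pascal xs a p q = pascal-below (degree a p q) refl
  where
  pascal-below : ∀ N → N ≡ degree a p q →
                 prev (Γ xs (coeff a p q)) N ≡
                 prev (Γ xs (shiftᵖ coeff a p q)) N + prev (Γ xs (shiftᑫ coeff a p q)) N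
  pascal-below zero    _     = sym (ℚₚ.+-identityʳ 0ℚ)
  pascal-below (suc n) n<deg =
    trans (Γ-cong xs n (λ b b+b≤n → coeff-pascal b a p q (subst (b ℕ.+ b <_) n<deg (s≤s b+b≤n))))
          (Γ-+ xs n _ _)

Ψ-cons : ∀ x xs a F →
         Ψ (x ∷ xs) a F ≡ Ψ xs a (λ R → F (x ∷ R)) + (x * x) * prev (λ a′ → Ψ xs a′ F) a
Ψ-cons x xs zero    F =
  sym (trans (cong (Ψ xs zero (λ R → F (x ∷ R)) +_) (ℚₚ.*-zeroʳ (x * x))) (ℚₚ.+-identityʳ _))
Ψ-cons x xs (suc a) F = refl

Ψ-esym²-cons : ∀ x xs a p q →
  Ψ xs a (λ R → esym (x ∷ R) p * esym (x ∷ R) q) ≡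
  Ψ xs a (λ R → esym R p * esym R q)
    + x * (Ψ xs a (λ R → prev (esym R) p * esym R q) + Ψ xs a (λ R → esym R p * prev (esym R) q))
    + (x * x) * Ψ xs a (λ R → prev (esym R) p * prev (esym R) q)
Ψ-esym²-cons x xs a p q = begin
  Ψ xs a (λ R → esym (x ∷ R) p * esym (x ∷ R) q)
    ≡⟨ Ψ-cong xs a (λ R → expand (esym R p) (prev (esym R) p) (esym R q) (prev (esym R) q) x) ⟩
  Ψ xs a (λ R → (E R + x * (L R + R′ R)) + (x * x) * P R)
    ≡⟨ Ψ-+ xs a _ _ ⟩
  Ψ xs a (λ R → E R + x * (L R + R′ R)) + Ψ xs a (λ R → (x * x) * P R)
    ≡⟨ cong₂ _+_ (Ψ-+ xs a E _) (Ψ-*ˡ xs a (x * x) P) ⟩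
  Ψ xs a E + Ψ xs a (λ R → x * (L R + R′ R)) + (x * x) * Ψ xs a P
    ≡⟨ cong (λ u → Ψ xs a E + u + (x * x) * Ψ xs a P)
            (trans (Ψ-*ˡ xs a x _) (cong (x *_) (Ψ-+ xs a L R′))) ⟩
  Ψ xs a E + x * (Ψ xs a L + Ψ xs a R′) + (x * x) * Ψ xs a P ∎
  where
  open ≡-Reasoning
  E L R′ P : List ℚ → ℚ
  E  R = esym R p * esym R q
  L  R = prev (esym R) p * esym R q
  R′ R = esym R p * prev (esym R) q
  P  R = prev (esym R) p * prev (esym R) q
  expand : ∀ e e′ f f′ x →
           (e + x * e′) * (f + x * f′) ≡ (e * f + x * (e′ * f + e * f′)) + (x * x) * (e′ * f′)
  expand = solve-∀ ℚ-ring

mutual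
  Ψ-esym² : ∀ xs a p q → Ψ xs a (λ R → esym R p * esym R q) ≡ Γ xs (coeff a p q) (degree a p q)
  Ψ-esym² []       zero    zero    zero    = refl
  Ψ-esym² []       zero    zero    (suc q) = refl
  Ψ-esym² []       zero    (suc p) q       = ℚₚ.*-zeroˡ (esym [] q)
  Ψ-esym² []       (suc a) p       q       = refl
  Ψ-esym² (x ∷ xs) a       p       q       = begin
    Ψ (x ∷ xs) a E
      ≡⟨ Ψ-cons x xs a E ⟩
    Ψ xs a (λ R → esym (x ∷ R) p * esym (x ∷ R) q) + (x * x) * prev (λ a′ → Ψ xs a′ E) a
      ≡⟨ cong (_+ (x * x) * prev (λ a′ → Ψ xs a′ E) a) (Ψ-esym²-cons x xs a p q) ⟩
    (Ψ xs a E + x * (Ψ xs a Eᵖ + Ψ xs a Eᑫ) + (x * x) * Ψ xs a Eᵖᑫ) + (x * x) * prev (λ a′ → Ψ xs a′ E) a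
      ≡⟨ cong₂ _+_ (cong₂ _+_ (cong₂ (λ u v → u + x * v) (Ψ-esym² xs a p q)
                                                          (cong₂ _+_ (Ψ-esym²ᵖ xs a p q) (Ψ-esym²ᑫ xs a p q)))
                              (cong ((x * x) *_) (Ψ-esym²ᵖᑫ xs a p q)))
                   (cong ((x * x) *_) (Ψ-esym²ᵃ xs a p q)) ⟩
    (Γ xs c N + x * (Γᵖ + Γᑫ) + (x * x) * Γᵖᑫ) + (x * x) * Γᵃ
      ≡⟨ regroup (Γ xs c N) x (Γᵖ + Γᑫ) Γᵖᑫ Γᵃ ⟩
    Γ xs c N + x * (Γᵖ + Γᑫ) + (x * x) * (Γᵃ + Γᵖᑫ)
      ≡⟨ cong₂ (λ u v → Γ xs c N + x * u + (x * x) * v) (Γ-pascal xs a p q) (prev²-Γ-+ xs N _ _) ⟨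
    Γ (x ∷ xs) c N ∎
    where
    open ≡-Reasoning
    E Eᵖ Eᑫ Eᵖᑫ : List ℚ → ℚ
    E   R = esym R p * esym R q
    Eᵖ  R = prev (esym R) p * esym R q
    Eᑫ  R = esym R p * prev (esym R) q
    Eᵖᑫ R = prev (esym R) p * prev (esym R) q
    N = degree a p q
    c = coeff a p q
    Γᵖ = prev (Γ xs (shiftᵖ coeff a p q)) N
    Γᑫ = prev (Γ xs (shiftᑫ coeff a p q)) N
    Γᵖᑫ = prev (prev (Γ xs (coeffProduct a p q))) N
    Γᵃ = prev (prev (Γ xs (coeffSquare a p q))) N
    regroup : ∀ u x v s t → (u + x * v + (x * x) * s) + (x * x) * t ≡ u + x * v + (x * x) * (t + s)
    regroup = solve-∀ ℚ-ring

  Ψ-esym²ᵖ : ∀ xs a p q →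
             Ψ xs a (λ R → prev (esym R) p * esym R q) ≡ prev (Γ xs (shiftᵖ coeff a p q)) (degree a p q)
  Ψ-esym²ᵖ xs a zero    q =
    trans (Ψ-cong xs a (λ R → ℚₚ.*-zeroˡ (esym R q)))
          (trans (Ψ-zero xs a) (sym (prev-zero (Γ-zero xs) (degree a zero q))))
  Ψ-esym²ᵖ xs a (suc p) q =
    trans (Ψ-esym² xs a p q) (sym (cong (prev (Γ xs (coeff a p q))) (degree-sucᵖ a p q)))

  Ψ-esym²ᑫ : ∀ xs a p q →
             Ψ xs a (λ R → esym R p * prev (esym R) q) ≡ prev (Γ xs (shiftᑫ coeff a p q)) (degree a p q)
  Ψ-esym²ᑫ xs a p zero    =
    trans (Ψ-cong xs a (λ R → ℚₚ.*-zeroʳ (esym R p)))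
          (trans (Ψ-zero xs a) (sym (prev-zero (Γ-zero xs) (degree a p zero))))
  Ψ-esym²ᑫ xs a p (suc q) =
    trans (Ψ-esym² xs a p q) (sym (cong (prev (Γ xs (coeff a p q))) (degree-sucᑫ a p q)))

  Ψ-esym²ᵖᑫ : ∀ xs a p q →
              Ψ xs a (λ R → prev (esym R) p * prev (esym R) q) ≡
              prev (prev (Γ xs (coeffProduct a p q))) (degree a p q)
  Ψ-esym²ᵖᑫ xs a zero    q       =
    trans (Ψ-cong xs a (λ R → ℚₚ.*-zeroˡ (prev (esym R) q)))
          (trans (Ψ-zero xs a) (sym (prev-zero (prev-zero (Γ-zero xs)) (degree a zero q))))
  Ψ-esym²ᵖᑫ xs a (suc p) zero    =
    trans (Ψ-cong xs a (λ R → ℚₚ.*-zeroʳ (esym R p)))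
          (trans (Ψ-zero xs a) (sym (prev-zero (prev-zero (Γ-zero xs)) (degree a (suc p) zero))))
  Ψ-esym²ᵖᑫ xs a (suc p) (suc q) =
    trans (Ψ-esym² xs a p q) (sym (cong (prev (prev (Γ xs (coeff a p q)))) (degree-sucᵖᑫ a p q)))

  Ψ-esym²ᵃ : ∀ xs a p q →
             prev (λ a′ → Ψ xs a′ (λ R → esym R p * esym R q)) a ≡
             prev (prev (Γ xs (coeffSquare a p q))) (degree a p q)
  Ψ-esym²ᵃ xs zero    p q = sym (prev-zero (prev-zero (Γ-zero xs)) (degree zero p q))
  Ψ-esym²ᵃ xs (suc a) p q =
    trans (Ψ-esym² xs a p q) (sym (cong (prev (prev (Γ xs (coeff a p q)))) (degree-sucᵃ a p q)))

Γ-splitSum : ∀ xs N K (g : ℕ → ℕ → ℕ → ℕ) →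
             Γ xs (λ b → splitSum ℕ._+_ K (λ a p → g a p b)) N ≡
             splitSum _+_ K (λ a p → Γ xs (g a p) N)
Γ-splitSum xs N zero    g = refl
Γ-splitSum xs N (suc K) g =
  trans (Γ-+ xs N (g 0 (suc K)) _) (cong (Γ xs (g 0 (suc K)) N +_) (Γ-splitSum xs N K (λ a p → g (suc a) p)))

newtonΔ : ℕ → List ℚ → ℚ
newtonΔ r zs = prev (esym zs) r * prev (esym zs) r - prev (prev (esym zs)) r * esym zs r

weightedSquares : ℕ → List ℚ → ℚ
weightedSquares K zs = splitSum _+_ K (λ a p → toℚ (a ! ℕ.* p !) * Ψ zs a (λ R → esym R p * esym R p))

newton-identity : ∀ K zs → toℚ ((suc K) !) * newtonΔ (suc K) zs ≡ weightedSquares K zs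
newton-identity K zs = begin
  toℚ D * (X - Y)  ≡⟨ solve-for-difference (toℚ D) X Y S DX≡DY+S ⟩
  S                ≡⟨ weighted ⟩
  weightedSquares K zs ∎
  where
  open ≡-Reasoning
  D = (suc K) !
  N = K ℕ.+ K
  X = esym zs K * esym zs K
  Y = prev (esym zs) K * esym zs (suc K)
  F : ℕ → ℕ
  F b = splitSum ℕ._+_ K (λ a p → a ! ℕ.* p ! ℕ.* coeff a p p b)
  S = Γ zs F N
  X≡Γ : X ≡ Γ zs (coeff 0 K K) N
  X≡Γ = trans (sym (Ψ-noSquares zs (λ R → esym R K * esym R K))) (Ψ-esym² zs 0 K K)
  Y≡Γ : Y ≡ Γ zs (shiftᵖ coeff 0 K (suc K)) N
  Y≡Γ = trans (sym (Ψ-noSquares zs (λ R → prev (esym R) K * esym R (suc K))))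
              (trans (Ψ-esym²ᵖ zs 0 K (suc K))
                     (cong (prev (Γ zs (shiftᵖ coeff 0 K (suc K)))) (degree-sucᑫ 0 K K)))
  DX≡DY+S : toℚ D * X ≡ toℚ D * Y + S
  DX≡DY+S = begin
    toℚ D * X                                        ≡⟨ cong (toℚ D *_) X≡Γ ⟩
    toℚ D * Γ zs (coeff 0 K K) N                     ≡⟨ Γ-*ˡ zs N D _ ⟨
    Γ zs (λ b → D ℕ.* coeff 0 K K b) N
      ≡⟨ Γ-cong zs N (λ b b+b≤N → coeff-newton K b (b+b≤K+K⇒b≤K b K b+b≤N)) ⟩
    Γ zs (λ b → D ℕ.* shiftᵖ coeff 0 K (suc K) b ℕ.+ F b) N
      ≡⟨ Γ-+ zs N _ F ⟩
    Γ zs (λ b → D ℕ.* shiftᵖ coeff 0 K (suc K) b) N + S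
      ≡⟨ cong (_+ S) (Γ-*ˡ zs N D _) ⟩
    toℚ D * Γ zs (shiftᵖ coeff 0 K (suc K)) N + S    ≡⟨ cong (λ y → toℚ D * y + S) Y≡Γ ⟨
    toℚ D * Y + S                                    ∎
  weighted : S ≡ weightedSquares K zs
  weighted = begin
    S ≡⟨ Γ-splitSum zs N K (λ a p b → a ! ℕ.* p ! ℕ.* coeff a p p b) ⟩
    splitSum _+_ K (λ a p → Γ zs (λ b → a ! ℕ.* p ! ℕ.* coeff a p p b) N)
      ≡⟨ splitSum-cong _+_ K (λ a p → Γ-*ˡ zs N (a ! ℕ.* p !) (coeff a p p)) ⟩
    splitSum _+_ K (λ a p → toℚ (a ! ℕ.* p !) * Γ zs (coeff a p p) (K ℕ.+ K))
      ≡⟨ splitSum-a+p≡K _+_ K (λ a p n → toℚ (a ! ℕ.* p !) * Γ zs (coeff a p p) (n ℕ.+ n)) ⟨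
    splitSum _+_ K (λ a p → toℚ (a ! ℕ.* p !) * Γ zs (coeff a p p) (degree a p p))
      ≡⟨ splitSum-cong _+_ K (λ a p → cong (toℚ (a ! ℕ.* p !) *_) (Ψ-esym² zs a p p)) ⟨
    splitSum _+_ K (λ a p → toℚ (a ! ℕ.* p !) * Ψ zs a (λ R → esym R p * esym R p)) ∎
  solve-for-difference : ∀ d x y s → d * x ≡ d * y + s → d * (x - y) ≡ s
  solve-for-difference d x y s dx≡dy+s = begin
    d * (x - y)          ≡⟨ distrib d x y ⟩
    d * x - d * y        ≡⟨ cong (_- d * y) dx≡dy+s ⟩
    (d * y + s) - d * y  ≡⟨ cancel (d * y) s ⟩
    s                    ∎
    where
    distrib : ∀ d x y → d * (x - y) ≡ d * x - d * y
    distrib = solve-∀ ℚ-ring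
    cancel : ∀ u s → (u + s) - u ≡ s
    cancel = solve-∀ ℚ-ring

evalAt : ∀ {n} → (Fin n → ℚ) → Poly n → ℚ
evalAt y p = eval p y

esymP : ∀ {n} → List (Poly n) → ℕ → Poly n
esymP []       zero    = con 1ℚ
esymP []       (suc k) = con 0ℚ
esymP (x ∷ xs) zero    = esymP xs zero ⊕ (x ⊗ con 0ℚ)
esymP (x ∷ xs) (suc k) = esymP xs (suc k) ⊕ (x ⊗ esymP xs k)

eval-esymP : ∀ {n} (y : Fin n → ℚ) ps k → eval (esymP ps k) y ≡ esym (map (evalAt y) ps) k
eval-esymP y []       zero    = refl
eval-esymP y []       (suc k) = refl
eval-esymP y (x ∷ ps) zero    = cong (_+ eval x y * 0ℚ) (eval-esymP y ps zero)
eval-esymP y (x ∷ ps) (suc k) =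
  cong₂ (λ u v → u + eval x y * v) (eval-esymP y ps (suc k)) (eval-esymP y ps k)

-- The entries are (∏_{j ∈ J} p_j) · f (ps ∖ J) for |J| = a.
Ψ-squares : ∀ {n} → List (Poly n) → ℕ → (List (Poly n) → Poly n) → List (Poly n)
Ψ-squares []       zero    f = f [] ∷ []
Ψ-squares []       (suc a) f = []
Ψ-squares (x ∷ xs) zero    f = Ψ-squares xs zero (λ R → f (x ∷ R))
Ψ-squares (x ∷ xs) (suc a) f = Ψ-squares xs (suc a) (λ R → f (x ∷ R)) ++ map (x ⊗_) (Ψ-squares xs a f)

sumℚ-++ : ∀ xs ys → sumℚ (xs ++ ys) ≡ sumℚ xs + sumℚ ys
sumℚ-++ []       ys = sym (ℚₚ.+-identityˡ (sumℚ ys))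
sumℚ-++ (x ∷ xs) ys = trans (cong (x +_) (sumℚ-++ xs ys)) (sym (ℚₚ.+-assoc x (sumℚ xs) (sumℚ ys)))

sumℚ-map-++ : ∀ {A : Set} (h : A → ℚ) xs ys →
              sumℚ (map h (xs ++ ys)) ≡ sumℚ (map h xs) + sumℚ (map h ys)
sumℚ-map-++ h xs ys = trans (cong sumℚ (map-++ h xs ys)) (sumℚ-++ (map h xs) (map h ys))

sumℚ-*ˡ : ∀ {A : Set} c (h : A → ℚ) xs → sumℚ (map (λ x → c * h x) xs) ≡ c * sumℚ (map h xs)
sumℚ-*ˡ c h []       = sym (ℚₚ.*-zeroʳ c)
sumℚ-*ˡ c h (x ∷ xs) = trans (cong (c * h x +_) (sumℚ-*ˡ c h xs)) (sym (ℚₚ.*-distribˡ-+ c (h x) _))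

sumℚ-filter : ∀ {A : Set} (c : A → Bool) (h : A → ℚ) xs →
              sumℚ (map h (filter (T? ∘ c) xs)) ≡ sumℚ (map (λ x → if c x then h x else 0ℚ) xs)
sumℚ-filter c h []       = refl
sumℚ-filter c h (x ∷ xs) with c x
... | true  = cong (h x +_) (sumℚ-filter c h xs)
... | false = trans (sumℚ-filter c h xs) (sym (ℚₚ.+-identityˡ _))

sumOfSquares-++ : ∀ {n} (y : Fin n → ℚ) qs rs →
                  sumOfSquares (qs ++ rs) y ≡ sumOfSquares qs y + sumOfSquares rs y
sumOfSquares-++ y = sumℚ-map-++ (λ q → eval q y * eval q y)

sumOfSquares-⊗ : ∀ {n} (y : Fin n → ℚ) q rs →
                 sumOfSquares (map (q ⊗_) rs) y ≡ (eval q y * eval q y) * sumOfSquares rs y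
sumOfSquares-⊗ y q []       = sym (ℚₚ.*-zeroʳ (eval q y * eval q y))
sumOfSquares-⊗ y q (r ∷ rs) =
  trans (cong ((eval q y * eval r y) * (eval q y * eval r y) +_) (sumOfSquares-⊗ y q rs))
        (regroup (eval q y) (eval r y) (sumOfSquares rs y))
  where
  regroup : ∀ a b s → (a * b) * (a * b) + (a * a) * s ≡ (a * a) * (b * b + s)
  regroup = solve-∀ ℚ-ring

sumOfSquares-replicate : ∀ {n} (y : Fin n → ℚ) k qs →
                         sumOfSquares (concat (replicate k qs)) y ≡ toℚ k * sumOfSquares qs y
sumOfSquares-replicate y zero    qs = sym (ℚₚ.*-zeroˡ (sumOfSquares qs y))
sumOfSquares-replicate y (suc k) qs =
  trans (sumOfSquares-++ y qs (concat (replicate k qs)))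
        (trans (cong (sumOfSquares qs y +_) (sumOfSquares-replicate y k qs))
               (regroup (toℚ k) (sumOfSquares qs y)))
  where
  regroup : ∀ t s → s + t * s ≡ (1ℚ + t) * s
  regroup = solve-∀ ℚ-ring

sumOfSquares-splitSum : ∀ {n} (y : Fin n → ℚ) K (L : ℕ → ℕ → List (Poly n)) →
                        sumOfSquares (splitSum _++_ K L) y ≡ splitSum _+_ K (λ a p → sumOfSquares (L a p) y)
sumOfSquares-splitSum y = splitSum-homo (λ qs → sumOfSquares qs y) (sumOfSquares-++ y)

sumOfSquares-Ψ-squares : ∀ {n} (y : Fin n → ℚ) ps a (f : List (Poly n) → Poly n) (F : List ℚ → ℚ) →
                         (∀ qs → eval (f qs) y ≡ F (map (evalAt y) qs)) →
                         sumOfSquares (Ψ-squares ps a f) y ≡ Ψ (map (evalAt y) ps) a (λ R → F R * F R)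
sumOfSquares-Ψ-squares y []       zero    f F f≈F =
  trans (ℚₚ.+-identityʳ _) (cong₂ _*_ (f≈F []) (f≈F []))
sumOfSquares-Ψ-squares y []       (suc a) f F f≈F = refl
sumOfSquares-Ψ-squares y (x ∷ ps) zero    f F f≈F =
  sumOfSquares-Ψ-squares y ps zero (f ∘ (x ∷_)) (F ∘ (eval x y ∷_)) (f≈F ∘ (x ∷_))
sumOfSquares-Ψ-squares y (x ∷ ps) (suc a) f F f≈F =
  trans (sumOfSquares-++ y (Ψ-squares ps (suc a) (λ R → f (x ∷ R))) (map (x ⊗_) (Ψ-squares ps a f)))
        (cong₂ _+_ (sumOfSquares-Ψ-squares y ps (suc a) (f ∘ (x ∷_)) (F ∘ (eval x y ∷_)) (f≈F ∘ (x ∷_)))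
                   (trans (sumOfSquares-⊗ y x (Ψ-squares ps a f))
                          (cong ((eval x y * eval x y) *_) (sumOfSquares-Ψ-squares y ps a f F f≈F))))

inverseFactorial : ℕ → ℚ
inverseFactorial n = (1/ toℚ (n !)) {{toℚ-nonZero (n !) {{n !≢0}}}}

inverseFactorial-inverse : ∀ n → inverseFactorial n * toℚ (n !) ≡ 1ℚ
inverseFactorial-inverse n = ℚₚ.*-inverseˡ (toℚ (n !)) {{toℚ-nonZero (n !) {{n !≢0}}}}

*-cancelˡ-invertible : ∀ c d x y → c * d ≡ 1ℚ → d * x ≡ d * y → x ≡ y
*-cancelˡ-invertible c d x y c*d≡1 d*x≡d*y = begin
  x              ≡⟨ trans (cong (_* x) c*d≡1) (ℚₚ.*-identityˡ x) ⟨
  (c * d) * x    ≡⟨ ℚₚ.*-assoc c d x ⟩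
  c * (d * x)    ≡⟨ cong (c *_) d*x≡d*y ⟩
  c * (d * y)    ≡⟨ ℚₚ.*-assoc c d y ⟨
  (c * d) * y    ≡⟨ trans (cong (_* y) c*d≡1) (ℚₚ.*-identityˡ y) ⟩
  y              ∎
  where open ≡-Reasoning

-- n copies of the square of q / (K+1)! sum to n q² / (K+1)!²; with n = a! p! (K+1)! this is the
-- weight a! p! / (K+1)! of the identity.
newtonSquares : ∀ {n} → ℕ → List (Poly n) → List (Poly n)
newtonSquares zero    ps = []
newtonSquares (suc K) ps = splitSum _++_ K λ a p →
  concat (replicate (a ! ℕ.* p ! ℕ.* (suc K) !)
                    (map (con (inverseFactorial (suc K)) ⊗_) (Ψ-squares ps a (λ R → esymP R p))))

splitSum-*ˡ : ∀ K c (F : ℕ → ℕ → ℚ) → splitSum _+_ K (λ a p → c * F a p) ≡ c * splitSum _+_ K F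
splitSum-*ˡ K c F = sym (splitSum-homo (c *_) (ℚₚ.*-distribˡ-+ c) K F)

newtonSquares-identity : ∀ {n} K ps (y : Fin n → ℚ) →
  toℚ ((suc K) !) * sumOfSquares (newtonSquares (suc K) ps) y ≡ weightedSquares K (map (evalAt y) ps)
newtonSquares-identity K ps y = begin
  toℚ D * sumOfSquares (newtonSquares (suc K) ps) y
    ≡⟨ cong (toℚ D *_) (sumOfSquares-splitSum y K _) ⟩
  toℚ D * splitSum _+_ K (λ a p → sumOfSquares (concat (replicate (m a p) (map (con c ⊗_) (L a p)))) y)
    ≡⟨ cong (toℚ D *_) (splitSum-cong _+_ K λ a p →
         trans (sumOfSquares-replicate y (m a p) (map (con c ⊗_) (L a p)))
               (cong₂ _*_ (toℚ-* (a ! ℕ.* p !) D)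
                      (trans (sumOfSquares-⊗ y (con c) (L a p))
                             (cong ((c * c) *_)
                                   (sumOfSquares-Ψ-squares y ps a _ (λ R → esym R p) (λ qs → eval-esymP y qs p)))))) ⟩
  toℚ D * splitSum _+_ K (λ a p → (toℚ (a ! ℕ.* p !) * toℚ D) * ((c * c) * P a p))
    ≡⟨ cong (toℚ D *_) (splitSum-cong _+_ K (λ a p → regroup (toℚ (a ! ℕ.* p !)) (toℚ D) c (P a p))) ⟩
  toℚ D * splitSum _+_ K (λ a p → (c * (c * toℚ D)) * (toℚ (a ! ℕ.* p !) * P a p))
    ≡⟨ cong (toℚ D *_) (splitSum-*ˡ K (c * (c * toℚ D)) _) ⟩
  toℚ D * ((c * (c * toℚ D)) * weightedSquares K zs)
    ≡⟨ regroup′ c (toℚ D) (weightedSquares K zs) ⟩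
  (c * toℚ D) * ((c * toℚ D) * weightedSquares K zs)
    ≡⟨ cong (λ u → u * (u * weightedSquares K zs)) (inverseFactorial-inverse (suc K)) ⟩
  1ℚ * (1ℚ * weightedSquares K zs)
    ≡⟨ trans (ℚₚ.*-identityˡ _) (ℚₚ.*-identityˡ _) ⟩
  weightedSquares K zs ∎
  where
  open ≡-Reasoning
  zs = map (evalAt y) ps
  D = (suc K) !
  c = inverseFactorial (suc K)
  m : ℕ → ℕ → ℕ
  m a p = a ! ℕ.* p ! ℕ.* D
  L : ℕ → ℕ → List (Poly _)
  L a p = Ψ-squares ps a (λ R → esymP R p)
  P : ℕ → ℕ → ℚ
  P a p = Ψ zs a (λ R → esym R p * esym R p)
  regroup : ∀ A d c P → (A * d) * ((c * c) * P) ≡ (c * (c * d)) * (A * P)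
  regroup = solve-∀ ℚ-ring
  regroup′ : ∀ c d w → d * ((c * (c * d)) * w) ≡ (c * d) * ((c * d) * w)
  regroup′ = solve-∀ ℚ-ring

newtonΔ-sumOfSquares : ∀ {n} r ps (y : Fin n → ℚ) →
                       newtonΔ r (map (evalAt y) ps) ≡ sumOfSquares (newtonSquares r ps) y
newtonΔ-sumOfSquares zero    ps y = vanish (esym (map (evalAt y) ps) 0)
  where
  vanish : ∀ e → 0ℚ * 0ℚ - 0ℚ * e ≡ 0ℚ
  vanish = solve-∀ ℚ-ring
newtonΔ-sumOfSquares (suc K) ps y =
  *-cancelˡ-invertible (inverseFactorial (suc K)) (toℚ ((suc K) !)) _ _ (inverseFactorial-inverse (suc K))
    (trans (newton-identity K (map (evalAt y) ps)) (sym (newtonSquares-identity K ps y)))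

subsetSum : (m : ℕ) → (Subset m → ℚ) → ℚ
subsetSum m h = sumℚ (map h (allSubsets m))

subsetSum-cong : ∀ m {h h′ : Subset m → ℚ} → (∀ B → h B ≡ h′ B) →
                 subsetSum m h ≡ subsetSum m h′
subsetSum-cong m h≗h′ = cong sumℚ (map-cong h≗h′ (allSubsets m))

subsetSum-*ˡ : ∀ m c (h : Subset m → ℚ) → subsetSum m (λ B → c * h B) ≡ c * subsetSum m h
subsetSum-*ˡ m c h = sumℚ-*ˡ c h (allSubsets m)

subsetSum-zero : ∀ m → subsetSum m (λ _ → 0ℚ) ≡ 0ℚ
subsetSum-zero m = trans (subsetSum-*ˡ m 0ℚ (λ _ → 0ℚ)) (ℚₚ.*-zeroˡ (subsetSum m (λ _ → 0ℚ)))

subsetSum-suc : ∀ m (h : Subset (suc m) → ℚ) →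
                subsetSum (suc m) h ≡ subsetSum m (h ∘ (outside ∷_)) + subsetSum m (h ∘ (inside ∷_))
subsetSum-suc m h =
  trans (sumℚ-map-++ h (map (outside ∷_) (allSubsets m)) (map (inside ∷_) (allSubsets m)))
        (sym (cong₂ _+_ (cong sumℚ (map-∘ (allSubsets m))) (cong sumℚ (map-∘ (allSubsets m)))))

rankSum : (m r : ℕ) → (Subset m → ℚ) → ℚ
rankSum m r h = subsetSum m (λ B → if ∣ B ∣ ℕ.≡ᵇ r then h B else 0ℚ)

-- The effect on rank-r sums of adjoining one element whose membership is weighted by w.
mark : (Bool → ℚ) → (ℕ → ℚ) → ℕ → ℚ
mark w F r = w false * F r + w true * prev F r

mark-cong : ∀ w {F G : ℕ → ℚ} → (∀ r → F r ≡ G r) → ∀ r → mark w F r ≡ mark w G r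
mark-cong w F≗G r = cong₂ (λ u v → w false * u + w true * v) (F≗G r) (prev-cong F≗G r)

prev-mark : ∀ w F r → prev (mark w F) r ≡ mark w (prev F) r
prev-mark w F zero    = vanish (w false) (w true)
  where
  vanish : ∀ a b → 0ℚ ≡ a * 0ℚ + b * 0ℚ
  vanish = solve-∀ ℚ-ring
prev-mark w F (suc r) = refl

mark-comm : ∀ v w F r → mark v (mark w F) r ≡ mark w (mark v F) r
mark-comm v w F r = begin
  mark v (mark w F) r
    ≡⟨ cong (λ z → v false * mark w F r + v true * z) (prev-mark w F r) ⟩
  v false * mark w F r + v true * mark w (prev F) r
    ≡⟨ exchange (v false) (v true) (w false) (w true) (F r) (prev F r) (prev (prev F) r) ⟩
  w false * mark v F r + w true * mark v (prev F) r
    ≡⟨ cong (λ z → w false * mark v F r + w true * z) (prev-mark v F r) ⟨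
  mark w (mark v F) r ∎
  where
  open ≡-Reasoning
  exchange : ∀ v₀ v₁ w₀ w₁ a b c →
             v₀ * (w₀ * a + w₁ * b) + v₁ * (w₀ * b + w₁ * c) ≡
             w₀ * (v₀ * a + v₁ * b) + w₁ * (v₀ * b + v₁ * c)
  exchange = solve-∀ ℚ-ring

if-*ˡ : ∀ c w x → (if c then w * x else 0ℚ) ≡ w * (if c then x else 0ℚ)
if-*ˡ true  w x = refl
if-*ˡ false w x = sym (ℚₚ.*-zeroʳ w)

rankSum-suc : ∀ m r (w : Bool → ℚ) (h : Subset (suc m) → ℚ) (g : Subset m → ℚ) →
              (∀ b B → h (b ∷ B) ≡ w b * g B) →
              rankSum (suc m) r h ≡ mark w (λ r′ → rankSum m r′ g) r
rankSum-suc m r w h g h≡wg = trans (subsetSum-suc m _) (cong₂ _+_ (weighted false r) (inside-part r))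
  where
  weighted : ∀ b r →
             subsetSum m (λ B → if ∣ B ∣ ℕ.≡ᵇ r then h (b ∷ B) else 0ℚ) ≡ w b * rankSum m r g
  weighted b r =
    trans (subsetSum-cong m λ B → trans (cong (λ x → if ∣ B ∣ ℕ.≡ᵇ r then x else 0ℚ) (h≡wg b B))
                                        (if-*ˡ (∣ B ∣ ℕ.≡ᵇ r) (w b) (g B)))
          (subsetSum-*ˡ m (w b) _)
  inside-part : ∀ r → subsetSum m (λ B → if suc ∣ B ∣ ℕ.≡ᵇ r then h (inside ∷ B) else 0ℚ) ≡
                      w true * prev (λ r′ → rankSum m r′ g) r
  inside-part zero    = trans (subsetSum-zero m) (sym (ℚₚ.*-zeroʳ (w true)))
  inside-part (suc r) = weighted true r

_^ᵇ_ : ℚ → Bool → ℚ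
x ^ᵇ b = if b then x else 1ℚ

esym-cons : ∀ x xs r → esym (x ∷ xs) r ≡ mark (x ^ᵇ_) (esym xs) r
esym-cons x xs r = cong (_+ x * prev (esym xs) r) (sym (ℚₚ.*-identityˡ (esym xs r)))

tabulateExcept : ∀ {m} {A : Set} → (Fin m → A) → Fin m → List A
tabulateExcept g zero    = tabulate (g ∘ suc)
tabulateExcept g (suc f) = g zero ∷ tabulateExcept (g ∘ suc) f

-- The value for e = f is arbitrary: it is only used when e ≢ f.
tabulateExcept₂ : ∀ {m} {A : Set} → (Fin m → A) → Fin m → Fin m → List A
tabulateExcept₂ g zero    zero    = tabulate (g ∘ suc)
tabulateExcept₂ g zero    (suc f) = tabulateExcept (g ∘ suc) f
tabulateExcept₂ g (suc e) zero    = tabulateExcept (g ∘ suc) e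
tabulateExcept₂ g (suc e) (suc f) = g zero ∷ tabulateExcept₂ (g ∘ suc) e f

map-tabulateExcept : ∀ {m} {A B : Set} (h : A → B) (g : Fin m → A) f →
                     map h (tabulateExcept g f) ≡ tabulateExcept (h ∘ g) f
map-tabulateExcept h g zero    = map-tabulate (g ∘ suc) h
map-tabulateExcept h g (suc f) = cong (h (g zero) ∷_) (map-tabulateExcept h (g ∘ suc) f)

map-tabulateExcept₂ : ∀ {m} {A B : Set} (h : A → B) (g : Fin m → A) e f →
                      map h (tabulateExcept₂ g e f) ≡ tabulateExcept₂ (h ∘ g) e f
map-tabulateExcept₂ h g zero    zero    = map-tabulate (g ∘ suc) h
map-tabulateExcept₂ h g zero    (suc f) = map-tabulateExcept h (g ∘ suc) f
map-tabulateExcept₂ h g (suc e) zero    = map-tabulateExcept h (g ∘ suc) e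
map-tabulateExcept₂ h g (suc e) (suc f) = cong (h (g zero) ∷_) (map-tabulateExcept₂ h (g ∘ suc) e f)

rankSum-monomial : ∀ m r (y : Fin m → ℚ) → rankSum m r (λ B → monomial B y) ≡ esym (tabulate y) r
rankSum-monomial zero    zero    y = ℚₚ.+-identityʳ 1ℚ
rankSum-monomial zero    (suc r) y = ℚₚ.+-identityʳ 0ℚ
rankSum-monomial (suc m) r       y = begin
  rankSum (suc m) r (λ B → monomial B y)
    ≡⟨ rankSum-suc m r (y zero ^ᵇ_) _ (λ B → monomial B (y ∘ suc)) (λ b B → refl) ⟩
  mark (y zero ^ᵇ_) (λ r′ → rankSum m r′ (λ B → monomial B (y ∘ suc))) r
    ≡⟨ mark-cong (y zero ^ᵇ_) (λ r′ → rankSum-monomial m r′ (y ∘ suc)) r ⟩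
  mark (y zero ^ᵇ_) (esym (tabulate (y ∘ suc))) r
    ≡⟨ esym-cons (y zero) (tabulate (y ∘ suc)) r ⟨
  esym (tabulate y) r ∎
  where open ≡-Reasoning

rankSum-except : ∀ m r f (q : Bool → ℚ) (y : Fin m → ℚ) →
                 rankSum m r (λ B → q (lookup B f) * monomial (B [ f ]≔ outside) y) ≡
                 mark q (esym (tabulateExcept y f)) r
rankSum-except (suc m) r zero    q y = begin
  rankSum (suc m) r (λ B → q (lookup B zero) * monomial (B [ zero ]≔ outside) y)
    ≡⟨ rankSum-suc m r q _ (λ B → monomial B (y ∘ suc)) (λ b B → cong (q b *_) (ℚₚ.*-identityˡ _)) ⟩
  mark q (λ r′ → rankSum m r′ (λ B → monomial B (y ∘ suc))) r
    ≡⟨ mark-cong q (λ r′ → rankSum-monomial m r′ (y ∘ suc)) r ⟩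
  mark q (esym (tabulate (y ∘ suc))) r ∎
  where open ≡-Reasoning
rankSum-except (suc m) r (suc f) q y = begin
  rankSum (suc m) r (λ B → q (lookup B (suc f)) * monomial (B [ suc f ]≔ outside) y)
    ≡⟨ rankSum-suc m r (y zero ^ᵇ_) _ (λ B → q (lookup B f) * monomial (B [ f ]≔ outside) (y ∘ suc))
                   (λ b B → x∙yz≈y∙xz (q (lookup B f)) (y zero ^ᵇ b) _) ⟩
  mark (y zero ^ᵇ_) (λ r′ → rankSum m r′ (λ B → q (lookup B f) * monomial (B [ f ]≔ outside) (y ∘ suc))) r
    ≡⟨ mark-cong (y zero ^ᵇ_) (λ r′ → rankSum-except m r′ f q (y ∘ suc)) r ⟩
  mark (y zero ^ᵇ_) (mark q E) r
    ≡⟨ mark-comm (y zero ^ᵇ_) q E r ⟩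
  mark q (mark (y zero ^ᵇ_) E) r
    ≡⟨ mark-cong q (esym-cons (y zero) (tabulateExcept (y ∘ suc) f)) r ⟨
  mark q (esym (tabulateExcept y (suc f))) r ∎
  where
  open ≡-Reasoning
  E = esym (tabulateExcept (y ∘ suc) f)

rankSum-except₂ : ∀ m r e f → e ≢ f → ∀ (p q : Bool → ℚ) (y : Fin m → ℚ) →
  rankSum m r (λ B → p (lookup B e) * (q (lookup B f) * monomial ((B [ e ]≔ outside) [ f ]≔ outside) y)) ≡
  mark p (mark q (esym (tabulateExcept₂ y e f))) r
rankSum-except₂ (suc m) r zero    zero    e≢f p q y = ⊥-elim (e≢f refl)
rankSum-except₂ (suc m) r zero    (suc f) e≢f p q y = begin
  rankSum (suc m) r _
    ≡⟨ rankSum-suc m r p _ (λ B → q (lookup B f) * monomial (B [ f ]≔ outside) (y ∘ suc))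
                   (λ b B → cong (λ z → p b * (q (lookup B f) * z)) (ℚₚ.*-identityˡ _)) ⟩
  mark p (λ r′ → rankSum m r′ (λ B → q (lookup B f) * monomial (B [ f ]≔ outside) (y ∘ suc))) r
    ≡⟨ mark-cong p (λ r′ → rankSum-except m r′ f q (y ∘ suc)) r ⟩
  mark p (mark q (esym (tabulateExcept (y ∘ suc) f))) r ∎
  where open ≡-Reasoning
rankSum-except₂ (suc m) r (suc e) zero    e≢f p q y = begin
  rankSum (suc m) r _
    ≡⟨ rankSum-suc m r q _ (λ B → p (lookup B e) * monomial (B [ e ]≔ outside) (y ∘ suc))
                   (λ b B → reorder (p (lookup B e)) (q b) _) ⟩
  mark q (λ r′ → rankSum m r′ (λ B → p (lookup B e) * monomial (B [ e ]≔ outside) (y ∘ suc))) r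
    ≡⟨ mark-cong q (λ r′ → rankSum-except m r′ e p (y ∘ suc)) r ⟩
  mark q (mark p (esym (tabulateExcept (y ∘ suc) e))) r
    ≡⟨ mark-comm q p _ r ⟩
  mark p (mark q (esym (tabulateExcept (y ∘ suc) e))) r ∎
  where
  open ≡-Reasoning
  reorder : ∀ a b x → a * (b * (1ℚ * x)) ≡ b * (a * x)
  reorder = solve-∀ ℚ-ring
rankSum-except₂ (suc m) r (suc e) (suc f) e≢f p q y = begin
  rankSum (suc m) r _
    ≡⟨ rankSum-suc m r (y zero ^ᵇ_) _
                   (λ B → p (lookup B e) * (q (lookup B f) * monomial ((B [ e ]≔ outside) [ f ]≔ outside) (y ∘ suc)))
                   (λ b B → reorder (p (lookup B e)) (q (lookup B f)) (y zero ^ᵇ b) _) ⟩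
  mark (y zero ^ᵇ_) (λ r′ → rankSum m r′ _) r
    ≡⟨ mark-cong (y zero ^ᵇ_) (λ r′ → rankSum-except₂ m r′ e f (e≢f ∘ cong suc) p q (y ∘ suc)) r ⟩
  mark (y zero ^ᵇ_) (mark p (mark q E)) r
    ≡⟨ mark-comm (y zero ^ᵇ_) p (mark q E) r ⟩
  mark p (mark (y zero ^ᵇ_) (mark q E)) r
    ≡⟨ mark-cong p (mark-comm (y zero ^ᵇ_) q E) r ⟩
  mark p (mark q (mark (y zero ^ᵇ_) E)) r
    ≡⟨ mark-cong p (mark-cong q (esym-cons (y zero) (tabulateExcept₂ (y ∘ suc) e f))) r ⟨
  mark p (mark q (esym (tabulateExcept₂ y (suc e) (suc f)))) r ∎
  where
  open ≡-Reasoning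
  E = esym (tabulateExcept₂ (y ∘ suc) e f)
  reorder : ∀ a b c x → a * (b * (c * x)) ≡ c * (a * (b * x))
  reorder = solve-∀ ℚ-ring

agree : Bool → Bool → Bool
agree true  b = b
agree false b = not b

indicator : Bool → ℚ
indicator b = if b then 1ℚ else 0ℚ

membership : Bool → Bool → ℚ
membership b u = indicator (agree u b)

-- partSum filters with a helper that is local to Defs and so cannot be named here;
-- unification names the whole filter predicate instead.
partSum-filtered : ∀ {m} (isB : BasisPred m) e f be bf (y : Fin m → ℚ) →
  Σ[ c ∈ (Subset m → Bool) ]
    partSum isB e f be bf y ≡
    sumℚ (map (λ B → monomial ((B [ e ]≔ outside) [ f ]≔ outside) y) (filter (T? ∘ c) (allSubsets m)))
partSum-filtered isB e f be bf y = _ , refl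

partSumCondition : ∀ {m} → BasisPred m → Fin m → Fin m → Bool → Bool → Subset m → Bool
partSumCondition isB e f be bf = proj₁ (partSum-filtered isB e f be bf (λ _ → 0ℚ))

partSumCondition-agree : ∀ {m} (isB : BasisPred m) e f be bf B →
                         partSumCondition isB e f be bf B ≡
                         isB B ∧ agree (lookup B e) be ∧ agree (lookup B f) bf
partSumCondition-agree isB e f be bf B with lookup B e | lookup B f
... | true  | true  = refl
... | true  | false = refl
... | false | true  = refl
... | false | false = refl

if-∧-indicator : ∀ s u v x →
                 (if s ∧ u ∧ v then x else 0ℚ) ≡ (if s then indicator u * (indicator v * x) else 0ℚ)
if-∧-indicator false u     v     x = refl
if-∧-indicator true  true  true  x = sym (trans (ℚₚ.*-identityˡ (1ℚ * x)) (ℚₚ.*-identityˡ x))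
if-∧-indicator true  true  false x = sym (trans (ℚₚ.*-identityˡ (0ℚ * x)) (ℚₚ.*-zeroˡ x))
if-∧-indicator true  false v     x = sym (ℚₚ.*-zeroˡ (indicator v * x))

partSum-uniform : ∀ r m (e f : Fin m) → e ≢ f → ∀ be bf y →
  partSum (uniformBases r m) e f be bf y ≡
  mark (membership be) (mark (membership bf) (esym (tabulateExcept₂ y e f))) r
partSum-uniform r m e f e≢f be bf y = begin
  partSum (uniformBases r m) e f be bf y
    ≡⟨ sumℚ-filter (partSumCondition (uniformBases r m) e f be bf) _ (allSubsets m) ⟩
  subsetSum m (λ B → if partSumCondition (uniformBases r m) e f be bf B then monomial (clear B) y else 0ℚ)
    ≡⟨ subsetSum-cong m summand ⟩
  rankSum m r (λ B → membership be (lookup B e) * (membership bf (lookup B f) * monomial (clear B) y))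
    ≡⟨ rankSum-except₂ m r e f e≢f (membership be) (membership bf) y ⟩
  mark (membership be) (mark (membership bf) (esym (tabulateExcept₂ y e f))) r ∎
  where
  open ≡-Reasoning
  clear : Subset m → Subset m
  clear B = (B [ e ]≔ outside) [ f ]≔ outside
  summand : ∀ B →
    (if partSumCondition (uniformBases r m) e f be bf B then monomial (clear B) y else 0ℚ) ≡
    (if ∣ B ∣ ℕ.≡ᵇ r then membership be (lookup B e) * (membership bf (lookup B f) * monomial (clear B) y)
                     else 0ℚ)
  summand B = trans (cong (λ c → if c then monomial (clear B) y else 0ℚ)
                          (partSumCondition-agree (uniformBases r m) e f be bf B))
                    (if-∧-indicator (∣ B ∣ ℕ.≡ᵇ r) (agree (lookup B e) be) (agree (lookup B f) bf) _)

mark-outside : ∀ F r → mark (membership false) F r ≡ F r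
mark-outside F r = simplify (F r) (prev F r)
  where
  simplify : ∀ a b → 1ℚ * a + 0ℚ * b ≡ a
  simplify = solve-∀ ℚ-ring

mark-inside : ∀ F r → mark (membership true) F r ≡ prev F r
mark-inside F r = simplify (F r) (prev F r)
  where
  simplify : ∀ a b → 0ℚ * a + 1ℚ * b ≡ b
  simplify = solve-∀ ℚ-ring

rayleighΔ-uniform : ∀ r m (e f : Fin m) → e ≢ f → ∀ y →
                    rayleighΔ (uniformBases r m) e f y ≡ newtonΔ r (tabulateExcept₂ y e f)
rayleighΔ-uniform r m e f e≢f y = cong₂ _-_ (cong₂ _*_ M-in-out M-out-in) (cong₂ _*_ M-in-in M-out-out)
  where
  E = esym (tabulateExcept₂ y e f)
  part : ∀ be bf → partSum (uniformBases r m) e f be bf y ≡ mark (membership be) (mark (membership bf) E) r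
  part be bf = partSum-uniform r m e f e≢f be bf y
  M-in-out : M_e^f (uniformBases r m) e f y ≡ prev E r
  M-in-out = trans (part true false)
                   (trans (mark-inside (mark (membership false) E) r) (prev-cong (mark-outside E) r))
  M-out-in : M_f^e (uniformBases r m) e f y ≡ prev E r
  M-out-in = trans (part false true) (trans (mark-outside (mark (membership true) E) r) (mark-inside E r))
  M-in-in : M_ef (uniformBases r m) e f y ≡ prev (prev E) r
  M-in-in = trans (part true true)
                  (trans (mark-inside (mark (membership true) E) r) (prev-cong (mark-inside E) r))
  M-out-out : M^ef (uniformBases r m) e f y ≡ E r
  M-out-out = trans (part false false) (trans (mark-outside (mark (membership false) E) r) (mark-outside E r))

proposition2p3 : (r m : ℕ) → r ≤ m → (e f : Fin m) → e ≢ f →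
    IsSOS (rayleighΔ (uniformBases r m) e f)
proposition2p3 r m _ e f e≢f = newtonSquares r zs , λ y → begin
  rayleighΔ (uniformBases r m) e f y      ≡⟨ rayleighΔ-uniform r m e f e≢f y ⟩
  newtonΔ r (tabulateExcept₂ y e f)       ≡⟨ cong (newtonΔ r) (map-tabulateExcept₂ (evalAt y) var e f) ⟨
  newtonΔ r (map (evalAt y) zs)           ≡⟨ newtonΔ-sumOfSquares r zs y ⟩
  sumOfSquares (newtonSquares r zs) y     ∎
  where
  open ≡-Reasoning
  zs = tabulateExcept₂ var e f
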